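{- Let $T$ be a proper partial transformation and let $\sigma$ be a finite binary string. Every escape sequence for $\sigma$ in $T$ contains a subsequence which is a reduced escape sequence for $\sigma$ in $T$.
   Context: Strings are finite binary strings; $\sigma\sqsubseteq\tau$ (also written $\sigma\subseteq\tau$) means $\sigma$ is an initial segment of $\tau$, $\langle\rangle$ is the empty string, $[\sigma]$ is the set of infinite binary sequences extending $\sigma$, and $\sigma^\frown\rho$ is concatenation. A partial transformation is a partial computable function $T:2^{<\omega}\to 2^{<\omega}$ such that if $\sigma\subseteq\tau$ and $T(\tau)$ is defined then $T(\sigma)$ is defined and $T(\sigma)\subseteq T(\tau)$. $T$ is proper if there are finite sets $T_-,T_+$ of strings such that: $T_-\cup T_+$ is prefix-free; $\bigcup_{\sigma\in T_-\cup T_+}[\sigma]=2^\omega$; if $\tau\sqsubseteq\sigma$ with $\tau\in T_-$ then $T(\sigma)=T(\tau)$; if $\sigma=\tau^\frown\rho$ with $\tau\in T_+$ then $T(\sigma)=T(\tau)^\frown\rho$; if $\sigma\in T_-$ then $|T(\sigma)|<|\sigma|$; if $\sigma\in T_+$ then $|T(\sigma)|=|\sigma|$; if $\sigma\in T_+$ and $\sigma\ne\tau\in T_+\cup T_-$ then $T(\tau)\not\supseteq T(\sigma)$. A string $\sigma$ is determined in $T$ if for some such $T_-,T_+$ some initial segment of $\sigma$ lies in $T_-\cup T_+$. A string $\tau$ is blocked if there is some $\sigma$ with $T(\sigma)\sqsupset\tau$, and unblocked otherwise. An escape sequence for $\sigma$ in $T$ is a sequence $\sigma_0,\ldots,\sigma_n$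 with $\sigma_0=\sigma$; $|\sigma_1|=\cdots=|\sigma_n|$; $\sigma_{i+1}\sqsupseteq T(\sigma_i)$ for all $0\le i<n$; if $\sigma_{i+1}$ is blocked then $\sigma_{i+1}=T(\sigma_i)$; $T(\sigma_n)=\langle\rangle$; and all $\sigma_i$ are determined. It is reduced if (1) $\sigma_i\supseteq T(\sigma_j)$ implies $i\le j+1$ or $\sigma_i$ is blocked, and (2) $T(\sigma_i)\ne\langle\rangle$ for $i<n$. -}

module Defs where

open import Data.Bool using (Bool)
open import Data.Nat using (ℕ; zero; suc; _≤_; _<_)
open import Data.Fin as Fin using (Fin; toℕ; inject₁; fromℕ)
open import Data.List using (List; []; _∷_; _++_; length; lookup)
open import Data.List.Membership.Propositional using (_∈_)
open import Data.List.Relation.Unary.Any using (Any)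
open import Data.Maybe using (Maybe; just; map)
open import Data.Product using (Σ; ∃; ∃-syntax; _×_; _,_)
open import Data.Sum using (_⊎_)
open import Relation.Binary.PropositionalEquality using (_≡_; _≢_)
open import Relation.Nullary using (¬_)

Str : Set
Str = List Bool

_⊑_ : Str → Str → Set
σ ⊑ τ = ∃[ ρ ] (σ ++ ρ ≡ τ)

_⊏_ : Str → Str → Set
σ ⊏ τ = σ ⊑ τ × σ ≢ τ

Seq : Set
Seq = ℕ → Bool

-- X ∈ [σ] : σ is an initial segment of the infinite sequence X.
_≺_ : Str → Seq → Set
σ ≺ X = (i : Fin (length σ)) → lookup σ i ≡ X (toℕ i)

-- A partial map on strings (partial: `nothing` = undefined).
-- T σ ≡ just v  means  "T(σ) is defined and equals v".
PMap : Set
PMap = Str → Maybe Str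

IsPartialTransformation : PMap → Set
IsPartialTransformation T =
  ∀ σ τ v → σ ⊑ τ → T τ ≡ just v → ∃[ u ] (T σ ≡ just u × u ⊑ v)

PrefixFree : List Str → Set
PrefixFree L = (i j : Fin (length L)) → i ≢ j → ¬ (lookup L i ⊑ lookup L j)

-- Tm, Tp witness that T is proper (Tm = T₋, Tp = T₊).
record ProperWitness (T : PMap) (Tm Tp : List Str) : Set where
  field
    prefixFree : PrefixFree (Tm ++ Tp)
    covers     : (X : Seq) → ∃[ τ ] (τ ∈ Tm ++ Tp × τ ≺ X)
    minusConst : ∀ τ σ → τ ∈ Tm → τ ⊑ σ → T σ ≡ T τ
    plusShift  : ∀ τ ρ → τ ∈ Tp → T (τ ++ ρ) ≡ map (_++ ρ) (T τ)
    minusShort : ∀ σ → σ ∈ Tm → ∃[ v ] (T σ ≡ just v × length v < length σ)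
    plusLen    : ∀ σ → σ ∈ Tp → ∃[ v ] (T σ ≡ just v × length v ≡ length σ)
    plusNoExt  : ∀ σ τ → σ ∈ Tp → τ ∈ Tm ++ Tp → σ ≢ τ →
                 ∀ u v → T σ ≡ just u → T τ ≡ just v → ¬ (u ⊑ v)

IsProper : PMap → Set
IsProper T = ∃[ Tm ] ∃[ Tp ] ProperWitness T Tm Tp

Determined : PMap → Str → Set
Determined T σ =
  ∃[ Tm ] ∃[ Tp ] (ProperWitness T Tm Tp × ∃[ τ ] (τ ∈ Tm ++ Tp × τ ⊑ σ))

Blocked : PMap → Str → Set
Blocked T τ = ∃[ σ ] ∃[ v ] (T σ ≡ just v × τ ⊏ v)

-- A sequence σ₀,…,σₙ is given by n and s : Fin (suc n) → Str, σᵢ = s i.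
record IsEscape (T : PMap) (σ : Str) (n : ℕ) (s : Fin (suc n) → Str) : Set where
  field
    start      : s Fin.zero ≡ σ
    sameLength : (i j : Fin n) → length (s (Fin.suc i)) ≡ length (s (Fin.suc j))
    extends    : (i : Fin n) → ∃[ v ] (T (s (inject₁ i)) ≡ just v × v ⊑ s (Fin.suc i))
    blockedEq  : (i : Fin n) → Blocked T (s (Fin.suc i)) → T (s (inject₁ i)) ≡ just (s (Fin.suc i))
    ends       : T (s (fromℕ n)) ≡ just []
    determined : (i : Fin (suc n)) → Determined T (s i)

record IsReducedEscape (T : PMap) (σ : Str) (n : ℕ) (s : Fin (suc n) → Str) : Set where
  field
    escape   : IsEscape T σ n s
    reduced1 : (i j : Fin (suc n)) → ∀ v → T (s j) ≡ just v → v ⊑ s i →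
               toℕ i ≤ suc (toℕ j) ⊎ Blocked T (s i)
    reduced2 : (i : Fin n) → T (s (inject₁ i)) ≢ just []

StrictlyIncreasing : ∀ {m n} → (Fin m → Fin n) → Set
StrictlyIncreasing f = ∀ i j → toℕ i < toℕ j → toℕ (f i) < toℕ (f j)

-- Proof idea: choose the subsequence greedily. From the current entry s_k, stop if
-- T(s_k) = ⟨⟩; otherwise jump to the LAST entry s_l (l > k) with T(s_k) ⊑ s_l that is
-- unblocked or equal to T(s_k). The next entry s_{k+1} is such a candidate, so l exists,
-- and the maximality of l is exactly reducedness condition (1). Making this choice
-- constructively needs blockedness to be decidable, which holds for proper T: every
-- input is comparable with some string of the finite basis T₋ ∪ T₊.

module Submission where

open import Defs
open import Data.Bool using (false)
import Data.Bool.Properties as Bool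
open import Data.Empty using (⊥-elim)
open import Data.Fin as Fin using (Fin; zero; suc; toℕ; inject₁; fromℕ)
import Data.Fin.Properties as Fin
open import Data.Fin.Induction using (>-wellFounded)
open import Data.List using (List; []; _∷_; _++_; length)
open import Data.List.Properties using (++-assoc; ++-identityʳ; ++-identityʳ-unique; ++-conicalˡ)
import Data.List.Properties as List
open import Data.List.Membership.Propositional using (_∈_; lose; find)
open import Data.List.Membership.Propositional.Properties using (∈-++⁻)
open import Data.List.Relation.Binary.Prefix.Heterogeneous using (Prefix; []; _∷_)
open import Data.List.Relation.Binary.Prefix.Heterogeneous.Properties using (prefix?)
open import Data.List.Relation.Unary.Any as Any using (Any; any?; satisfied)
open import Data.Maybe as Maybe using (just; nothing)
open import Data.Maybe.Properties using (just-injective)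
open import Data.Nat using (ℕ; suc; _≤_; _<_; z≤n; s≤s)
open import Data.Nat.Properties using (≤-refl; ≤-reflexive; <⇒≤; <-≤-trans; <-trans; ≤-<-trans)
open import Data.Product using (∃; ∃-syntax; _×_; _,_; proj₁; proj₂)
open import Data.Sum as Sum using (_⊎_; inj₁; inj₂)
open import Function using (_∘_)
open import Level using (0ℓ)
open import Induction.WellFounded using (WfRec; module All)
open import Relation.Binary.PropositionalEquality using (_≡_; _≢_; refl; sym; trans; cong; subst)
open import Relation.Nullary using (¬_; Dec; yes; no)
open import Relation.Nullary.Decidable using (map′; _×-dec_; _⊎-dec_; _→-dec_; ¬?)
open import Relation.Unary using (Pred; Decidable)

_≟_ : (x y : Str) → Dec (x ≡ y)
_≟_ = List.≡-dec Bool._≟_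

⊑-refl : ∀ {x} → x ⊑ x
⊑-refl {x} = [] , ++-identityʳ x

⊑-trans : ∀ {x y z} → x ⊑ y → y ⊑ z → x ⊑ z
⊑-trans {x} (ρ , refl) (ρ′ , refl) = ρ ++ ρ′ , sym (++-assoc x ρ ρ′)

∷-⊑ : ∀ b {x y} → x ⊑ y → (b ∷ x) ⊑ (b ∷ y)
∷-⊑ b (ρ , refl) = ρ , refl

⊑⇒Prefix : ∀ {x y} → x ⊑ y → Prefix _≡_ x y
⊑⇒Prefix {[]}    _        = []
⊑⇒Prefix {b ∷ x} (ρ , refl) = refl ∷ ⊑⇒Prefix (ρ , refl)

Prefix⇒⊑ : ∀ {x y} → Prefix _≡_ x y → x ⊑ y
Prefix⇒⊑ {y = y} []    = y , refl
Prefix⇒⊑ (refl ∷ p) = ∷-⊑ _ (Prefix⇒⊑ p)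

⊑-antisym : ∀ {x y} → x ⊑ y → y ⊑ x → x ≡ y
⊑-antisym {x} (ρ , refl) (ρ′ , x++ρ++ρ′≡x) = sym (trans (cong (x ++_) ρ≡[]) (++-identityʳ x))
  where
  ρ≡[] : ρ ≡ []
  ρ≡[] = ++-conicalˡ ρ ρ′ (++-identityʳ-unique x (trans (sym x++ρ++ρ′≡x) (++-assoc x ρ ρ′)))

_⊑?_ : ∀ x y → Dec (x ⊑ y)
x ⊑? y = map′ Prefix⇒⊑ ⊑⇒Prefix (prefix? Bool._≟_ x y)

_⊏?_ : ∀ x y → Dec (x ⊏ y)
x ⊏? y = x ⊑? y ×-dec ¬? (x ≟ y)

⊏-⊑-trans : ∀ {x y z} → x ⊏ y → y ⊑ z → x ⊏ z
⊏-⊑-trans (x⊑y , x≢y) y⊑z =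
  ⊑-trans x⊑y y⊑z , λ { refl → x≢y (⊑-antisym x⊑y y⊑z) }

⊏-++-∷ : ∀ x b ys → x ⊏ (x ++ b ∷ ys)
⊏-++-∷ x b ys = (b ∷ ys , refl) , λ x≡x++b∷ys → b∷ys≢[] (++-identityʳ-unique x x≡x++b∷ys)
  where
  b∷ys≢[] : b ∷ ys ≢ []
  b∷ys≢[] ()

prefix-comparable : ∀ {x y z : Str} → Prefix _≡_ x z → Prefix _≡_ y z →
                    Prefix _≡_ x y ⊎ Prefix _≡_ y x
prefix-comparable []         _          = inj₁ []
prefix-comparable (_ ∷ _)    []         = inj₂ []
prefix-comparable (refl ∷ p) (refl ∷ q) = Sum.map (refl ∷_) (refl ∷_) (prefix-comparable p q)

⊑-comparable : ∀ {x y z} → x ⊑ z → y ⊑ z → x ⊑ y ⊎ y ⊑ x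
⊑-comparable x⊑z y⊑z =
  Sum.map Prefix⇒⊑ Prefix⇒⊑ (prefix-comparable (⊑⇒Prefix x⊑z) (⊑⇒Prefix y⊑z))

pad : Str → Seq
pad []      _       = false
pad (b ∷ α) 0       = b
pad (b ∷ α) (suc i) = pad α i

≺-pad⇒comparable : ∀ τ α → τ ≺ pad α → τ ⊑ α ⊎ α ⊑ τ
≺-pad⇒comparable []      α       _    = inj₁ (α , refl)
≺-pad⇒comparable (c ∷ τ) []      _    = inj₂ (c ∷ τ , refl)
≺-pad⇒comparable (c ∷ τ) (b ∷ α) τ≺α with τ≺α zero
... | refl = Sum.map (∷-⊑ c) (∷-⊑ c) (≺-pad⇒comparable τ α (τ≺α ∘ suc))

data LastView : ∀ {n} → Fin (suc n) → Set where
  last  : ∀ {n} → LastView (fromℕ n)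
  below : ∀ {n} (i : Fin n) → LastView (inject₁ i)

lastView : ∀ {n} (k : Fin (suc n)) → LastView k
lastView {0}     zero    = last
lastView {suc n} zero    = below zero
lastView {suc n} (suc k) with lastView k
... | last    = last
... | below i = below (suc i)

lastSatisfying : ∀ {n p} {P : Pred (Fin n) p} → Decidable P → ∃ P →
                 ∃[ l ] (P l × ∀ {l′} → l Fin.< l′ → ¬ P l′)
lastSatisfying {suc n} P? (l , Pl) with Fin.any? (P? ∘ suc) | l
... | yes ∃P∘suc | _ with lastSatisfying (P? ∘ suc) ∃P∘suc
...   | l′ , Pl′ , after = suc l′ , Pl′ , λ { {suc j} (s≤s l′<j) → after l′<j }
lastSatisfying {suc n} P? (l , Pl) | no ¬∃P∘suc | zero = zero , Pl , λ { {suc j} _ Pj → ¬∃P∘suc (j , Pj) }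
lastSatisfying {suc n} P? (l , Pl) | no ¬∃P∘suc | suc j = ⊥-elim (¬∃P∘suc (j , Pl))

strictlyIncreasing-zero-least : ∀ {m n} {f : Fin (suc m) → Fin (suc n)} → StrictlyIncreasing f →
                                ∀ i → toℕ (f zero) ≤ toℕ (f i)
strictlyIncreasing-zero-least f-inc zero    = ≤-refl
strictlyIncreasing-zero-least f-inc (suc i) = <⇒≤ (f-inc zero (suc i) (s≤s z≤n))

module BlockedDecidable (T : PMap) (pt : IsPartialTransformation T)
                        {Tm Tp : List Str} (W : ProperWitness T Tm Tp) where
  open ProperWitness W

  HasOutput : Pred Str 0ℓ → Pred Str 0ℓ
  HasOutput P τ = ∃[ u ] (T τ ≡ just u × P u)

  hasOutput? : ∀ {P : Pred Str 0ℓ} → Decidable P → Decidable (HasOutput P)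
  hasOutput? {P} P? τ = just? (T τ)
    where
    just? : ∀ m → Dec (∃[ u ] (m ≡ just u × P u))
    just? nothing  = no λ { (_ , () , _) }
    just? (just u) = map′ (λ Pu → u , refl , Pu) (λ { (_ , refl , Pu) → Pu }) (P? u)

  -- Blockedness can be read off the finitely many strings of T₋ ∪ T₊; in the second
  -- disjunct, with x = T(τ) ++ ρ, the input τ ++ ρ ++ [0] has output x ++ [0].
  BlockedOnBasis : Pred Str 0ℓ
  BlockedOnBasis x = Any (HasOutput (x ⊏_)) (Tm ++ Tp) ⊎ Any (HasOutput (_⊑ x)) Tp

  basis-defined : ∀ {τ} → τ ∈ Tm ++ Tp → ∃[ u ] (T τ ≡ just u)
  basis-defined {τ} τ∈ with ∈-++⁻ Tm τ∈
  ... | inj₁ τ∈Tm = let (u , Tτ≡u , _) = minusShort τ τ∈Tm in u , Tτ≡u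
  ... | inj₂ τ∈Tp = let (u , Tτ≡u , _) = plusLen τ τ∈Tp in u , Tτ≡u

  output-mono : ∀ {α τ v u} → α ⊑ τ → T α ≡ just v → T τ ≡ just u → v ⊑ u
  output-mono {α} {τ} {u = u} α⊑τ Tα≡v Tτ≡u with pt α τ u α⊑τ Tτ≡u
  ... | w , Tα≡w , w⊑u = subst (_⊑ u) (just-injective (trans (sym Tα≡w) Tα≡v)) w⊑u

  plus-output : ∀ {τ u} ρ → τ ∈ Tp → T τ ≡ just u → T (τ ++ ρ) ≡ just (u ++ ρ)
  plus-output {τ} ρ τ∈Tp Tτ≡u = trans (plusShift τ ρ τ∈Tp) (cong (Maybe.map (_++ ρ)) Tτ≡u)

  blockedOnBasis⇒blocked : ∀ {x} → BlockedOnBasis x → Blocked T x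
  blockedOnBasis⇒blocked (inj₁ any) = satisfied any
  blockedOnBasis⇒blocked (inj₂ any) with find any
  ... | τ , τ∈Tp , u , Tτ≡u , (ρ , refl) =
    τ ++ ρ′ , u ++ ρ′ , plus-output ρ′ τ∈Tp Tτ≡u ,
    subst ((u ++ ρ) ⊏_) (++-assoc u ρ (false ∷ [])) (⊏-++-∷ (u ++ ρ) false [])
    where
    ρ′ = ρ ++ false ∷ []

  blocked⇒blockedOnBasis : ∀ {x} → Blocked T x → BlockedOnBasis x
  blocked⇒blockedOnBasis {x} (α , v , Tα≡v , x⊏v) with covers (pad α)
  ... | τ , τ∈ , τ≺α with ≺-pad⇒comparable τ α τ≺α
  ... | inj₂ α⊑τ =
    let (u , Tτ≡u) = basis-defined τ∈ in
    inj₁ (lose τ∈ (u , Tτ≡u , ⊏-⊑-trans x⊏v (output-mono α⊑τ Tα≡v Tτ≡u)))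
  ... | inj₁ τ⊑α with ∈-++⁻ Tm τ∈
  ...   | inj₁ τ∈Tm = inj₁ (lose τ∈ (v , trans (sym (minusConst τ α τ∈Tm τ⊑α)) Tα≡v , x⊏v))
  ...   | inj₂ τ∈Tp with τ⊑α | plusLen τ τ∈Tp
  ...     | ρ , refl | u , Tτ≡u , _ with just-injective (trans (sym Tα≡v) (plus-output ρ τ∈Tp Tτ≡u))
  ...     | refl with ⊑-comparable (proj₁ x⊏v) (ρ , refl)
  ...       | inj₂ u⊑x = inj₂ (lose τ∈Tp (u , Tτ≡u , u⊑x))
  ...       | inj₁ x⊑u with x ≟ u
  ...         | yes refl = inj₂ (lose τ∈Tp (u , Tτ≡u , ⊑-refl))
  ...         | no x≢u   = inj₁ (lose τ∈ (u , Tτ≡u , x⊑u , x≢u))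

  blocked? : Decidable (Blocked T)
  blocked? x = map′ blockedOnBasis⇒blocked blocked⇒blockedOnBasis
    (any? (hasOutput? (x ⊏?_)) (Tm ++ Tp) ⊎-dec any? (hasOutput? (_⊑? x)) Tp)

module Reduction (T : PMap) (blocked? : Decidable (Blocked T))
                 {σ : Str} {n : ℕ} {s : Fin (suc n) → Str} (E : IsEscape T σ n s) where
  module E = IsEscape E

  ValidSuccessor : Str → Str → Set
  ValidSuccessor a t = a ⊑ t × (Blocked T t → a ≡ t)

  validSuccessor? : ∀ a t → Dec (ValidSuccessor a t)
  validSuccessor? a t = a ⊑? t ×-dec (blocked? t →-dec a ≟ t)

  step-valid : ∀ i → ∃[ a ] (T (s (inject₁ i)) ≡ just a × ValidSuccessor a (s (suc i)))
  step-valid i with E.extends i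
  ... | a , Tsi≡a , a⊑ = a , Tsi≡a , a⊑ , λ b → just-injective (trans (sym Tsi≡a) (E.blockedEq i b))

  sameLength-positive : ∀ {p q : Fin (suc n)} → 0 < toℕ p → 0 < toℕ q → length (s p) ≡ length (s q)
  sameLength-positive {suc p} {suc q} _ _ = E.sameLength p q

  record ReducedEscapeFrom (k : Fin (suc n)) : Set where
    field
      m          : ℕ
      f          : Fin (suc m) → Fin (suc n)
      f-zero     : f zero ≡ k
      increasing : StrictlyIncreasing f
      reduced    : IsReducedEscape T (s k) m (s ∘ f)

  stop : ∀ {k} → T (s k) ≡ just [] → ReducedEscapeFrom k
  stop {k} Tsk≡[] = record
    { m = 0 ; f = λ _ → k ; f-zero = refl
    ; increasing = λ { zero zero () }
    ; reduced = record
      { escape = record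
        { start = refl ; sameLength = λ () ; extends = λ () ; blockedEq = λ ()
        ; ends = Tsk≡[] ; determined = λ _ → E.determined k }
      ; reduced1 = λ { zero _ _ _ _ → inj₁ z≤n }
      ; reduced2 = λ () } }

  prepend : ∀ {k a l} → T (s k) ≡ just a → a ≢ [] → toℕ k < toℕ l → ValidSuccessor a (s l) →
            (∀ {l′} → l Fin.< l′ → ¬ ValidSuccessor a (s l′)) →
            ReducedEscapeFrom l → ReducedEscapeFrom k
  prepend {k} {a} {l} Tsk≡a a≢[] k<l valid maximal R = record
    { m = suc m ; f = f′ ; f-zero = refl ; increasing = increasing′
    ; reduced = record
      { escape = record
        { start      = refl
        ; sameLength = λ i j → sameLength-positive (positive i) (positive j)
        ; extends    = λ { zero → a , Tsk≡a , proj₁ valid₀ ; (suc i) → extends i }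
        ; blockedEq  = λ { zero b → trans Tsk≡a (cong just (proj₂ valid₀ b)) ; (suc i) → blockedEq i }
        ; ends       = ends
        ; determined = E.determined ∘ f′ }
      ; reduced1 = reduced1′
      ; reduced2 = λ { zero Tsk≡[] → a≢[] (just-injective (trans (sym Tsk≡a) Tsk≡[])) ; (suc i) → reduced2 i } } }
    where
    open ReducedEscapeFrom R
    open IsReducedEscape reduced using (escape; reduced1; reduced2)
    open IsEscape escape using (extends; blockedEq; ends)

    f′ : Fin (suc (suc m)) → Fin (suc n)
    f′ zero    = k
    f′ (suc i) = f i

    valid₀ : ValidSuccessor a (s (f zero))
    valid₀ = subst (ValidSuccessor a ∘ s) (sym f-zero) valid

    l<f : ∀ i → toℕ l < toℕ (f (suc i))
    l<f i = subst (λ p → toℕ p < toℕ (f (suc i))) f-zero (increasing zero (suc i) (s≤s z≤n))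

    k<f : ∀ i → toℕ k < toℕ (f i)
    k<f i = <-≤-trans k<l (subst (λ p → toℕ p ≤ toℕ (f i)) f-zero (strictlyIncreasing-zero-least increasing i))

    positive : ∀ i → 0 < toℕ (f i)
    positive i = ≤-<-trans z≤n (k<f i)

    increasing′ : StrictlyIncreasing f′
    increasing′ zero    (suc j) _         = k<f j
    increasing′ (suc i) (suc j) (s≤s i<j) = increasing i j i<j

    -- An unblocked s_i above T(s_k) would be a valid successor of s_k later than s_l.
    reduced1′ : ∀ i j v → T (s (f′ j)) ≡ just v → v ⊑ s (f′ i) →
                toℕ i ≤ suc (toℕ j) ⊎ Blocked T (s (f′ i))
    reduced1′ zero          _       _ _     _   = inj₁ z≤n
    reduced1′ (suc zero)    zero    _ _     _   = inj₁ (s≤s z≤n)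
    reduced1′ (suc (suc i)) zero    v Tsk≡v v⊑ with blocked? (s (f (suc i)))
    ... | yes b  = inj₂ b
    ... | no ¬b with just-injective (trans (sym Tsk≡a) Tsk≡v)
    ...   | refl = ⊥-elim (maximal (l<f i) (v⊑ , λ b → ⊥-elim (¬b b)))
    reduced1′ (suc i)       (suc j) v Tsj≡v v⊑ = Sum.map₁ s≤s (reduced1 i j v Tsj≡v v⊑)

  reducedEscapeFrom : ∀ k → ReducedEscapeFrom k
  reducedEscapeFrom = All.wfRec >-wellFounded 0ℓ ReducedEscapeFrom step
    where
    step : ∀ k → WfRec Fin._>_ ReducedEscapeFrom k → ReducedEscapeFrom k
    step k rec with lastView k
    ... | last    = stop E.ends
    ... | below i with step-valid i
    ...   | []        , Tsk≡[] , _     = stop Tsk≡[]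
    ...   | a@(_ ∷ _) , Tsk≡a  , valid with lastSatisfying (λ l → inject₁ i Fin.<? l ×-dec validSuccessor? a (s l))
                                                          (suc i , s≤s (≤-reflexive (Fin.toℕ-inject₁ i)) , valid)
    ...     | l , (k<l , validₗ) , maximal =
      prepend Tsk≡a (λ ()) k<l validₗ (λ l<l′ valid′ → maximal l<l′ (<-trans k<l l<l′ , valid′)) (rec k<l)

mainTheorem5 : (T : PMap) → IsPartialTransformation T → IsProper T →
    (σ : Str) (n : ℕ) (s : Fin (suc n) → Str) → IsEscape T σ n s →
    ∃[ m ] ∃[ f ] (StrictlyIncreasing {suc m} {suc n} f × IsReducedEscape T σ m (s ∘ f))
mainTheorem5 T pt (_ , _ , W) σ n s E =
  m , f , increasing , subst (λ τ → IsReducedEscape T τ m (s ∘ f)) (IsEscape.start E) reduced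
  where
  open Reduction T (BlockedDecidable.blocked? T pt W) E
  open ReducedEscapeFrom (reducedEscapeFrom zero)
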